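{- Let $G$ be a simple graph and $k$ a positive integer. Then $\mathrm{ctw}({}^kG)\le\mathrm{ctw}(G)$, $\mathrm{ctw}({}_kG)\le k\,\mathrm{ctw}(G)$ and $\mathrm{ctw}({}_{(k)}G)\le\mathrm{ctw}(G)+k-1$.
   Context: For a (multi)graph $H$, a cut decomposition is an ordering $v_1,\dots,v_n$ of $V(H)$; its width is the maximum over $i$ of the number of edges (counted with multiplicity) $v_jv_l$ with $j\le i<l$; the cutwidth $\mathrm{ctw}(H)$ is the minimum width over all cut decompositions. The $k$-stretch ${}^kG$ is obtained from $G$ by replacing every edge by a path of length $k$. The $k$-thickening ${}_kG$ is obtained by replacing every edge by $k$ parallel edges. The insulated $k$-thickening ${}_{(k)}G$ is obtained by replacing every edge by a path of length $3$ and then replacing the middle edge of each such path by $k$ parallel edges. -}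

module Defs where

open import Data.Nat using (ℕ; zero; suc; _+_; _*_; _∸_; _≤_; _<_; _⊔_; _≤ᵇ_; _<ᵇ_)
open import Data.Bool using (Bool; true; false; _∧_; _∨_; if_then_else_)
open import Data.Fin using (Fin; toℕ; _↑ˡ_; _↑ʳ_; combine; zero; suc)
open import Data.Fin.Permutation using (Permutation′; _⟨$⟩ʳ_)
open import Data.List using (List; []; _∷_; _++_; map; concatMap; replicate; length; lookup; allFin; upTo; foldr)
open import Data.List.Relation.Unary.All using (All)
open import Data.List.Relation.Unary.Unique.Propositional using (Unique)
open import Relation.Binary.PropositionalEquality using (_≡_)
open import Data.Product using (_×_; _,_; proj₁; proj₂; Σ; ∃)

-- Multigraphs: vertex set Fin n, edges a list of (unordered) pairs;
-- the multiplicity of an edge is the number of times it occurs in the list.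

record Multigraph : Set where
  constructor mg
  field
    n     : ℕ
    edges : List (Fin n × Fin n)

record SimpleGraph : Set where
  field
    n      : ℕ
    edges  : List (Fin n × Fin n)
    canon  : All (λ e → toℕ (proj₁ e) < toℕ (proj₂ e)) edges
    unique : Unique edges

toMulti : SimpleGraph → Multigraph
toMulti G = mg (SimpleGraph.n G) (SimpleGraph.edges G)

Ordering : Multigraph → Set
Ordering H = Permutation′ (Multigraph.n H)

module _ (H : Multigraph) (π : Ordering H) where
  open Multigraph H

  pos : Fin n → ℕ
  pos v = toℕ (π ⟨$⟩ʳ v)

  crosses : ℕ → Fin n × Fin n → Bool
  crosses i (u , v) = ((pos u ≤ᵇ i) ∧ (i <ᵇ pos v)) ∨ ((pos v ≤ᵇ i) ∧ (i <ᵇ pos u))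

  cutSize : ℕ → ℕ
  cutSize i = foldr (λ e acc → (if crosses i e then 1 else 0) + acc) 0 edges

  width : ℕ
  width = foldr _⊔_ 0 (map cutSize (upTo n))

IsCutwidth : Multigraph → ℕ → Set
IsCutwidth H c = (Σ (Ordering H) λ π → width H π ≡ c) × ((π : Ordering H) → c ≤ width H π)

module _ (G : SimpleGraph) where
  open SimpleGraph G

  m : ℕ
  m = length edges

  edge : Fin m → Fin n × Fin n
  edge j = lookup edges j

  pathEdges : {N : ℕ} → Fin N → List (Fin N) → Fin N → List (Fin N × Fin N)
  pathEdges a []       b = (a , b) ∷ []
  pathEdges a (x ∷ xs) b = (a , x) ∷ pathEdges x xs b

  -- k-stretch: each edge replaced by a path of length k (k ≥ 1);
  -- edge j gets k ∸ 1 new internal vertices  n ↑ʳ combine j t.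
  stretch : ℕ → Multigraph
  stretch k = mg (n + m * (k ∸ 1)) (concatMap pathOf (allFin m))
    where
    pathOf : Fin m → List (Fin (n + m * (k ∸ 1)) × Fin (n + m * (k ∸ 1)))
    pathOf j = pathEdges (proj₁ (edge j) ↑ˡ (m * (k ∸ 1)))
                         (map (λ t → n ↑ʳ combine j t) (allFin (k ∸ 1)))
                         (proj₂ (edge j) ↑ˡ (m * (k ∸ 1)))

  thicken : ℕ → Multigraph
  thicken k = mg n (concatMap (replicate k) edges)

  insulated : ℕ → Multigraph
  insulated k = mg (n + m * 2) (concatMap pieces (allFin m))
    where
    pieces : Fin m → List (Fin (n + m * 2) × Fin (n + m * 2))
    pieces j = (u , a) ∷ (replicate k (a , b) ++ ((b , v) ∷ []))
      where
      u = proj₁ (edge j) ↑ˡ (m * 2)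
      v = proj₂ (edge j) ↑ˡ (m * 2)
      a = n ↑ʳ combine j zero
      b = n ↑ʳ combine j (suc zero)

{-# OPTIONS --safe #-}
-- Fix an optimal ordering of G. The thickening keeps it, and every cut is crossed k times as
-- often. For the stretch and the insulated thickening, the new vertices on the path replacing an
-- edge uv, with u before v, are inserted right after u in the order met along the path. A cut of
-- the new ordering then restricts to a cut of the old one on V(G), and along each path the side
-- changes at most once, exactly when uv crosses that cut; so each path contributes as many
-- crossing edges as its edge did. In the insulated thickening the ends of each heavy middle edge
-- have consecutive keys, so a cut crosses at most one of these edges, adding at most k - 1.
module Submission where

open import Defs
open import Data.Bool as Bool using (Bool; true; false; not; _xor_; if_then_else_; T)
open import Data.Bool.Properties using (xor-comm)
open import Data.Empty using (⊥-elim)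
open import Data.Fin as Fin using (Fin; toℕ; fromℕ<; punchOut; _↑ˡ_; _↑ʳ_; combine; remQuot; splitAt; join; opposite)
open import Data.Fin.Properties using (any?; toℕ-fromℕ<; injective⇒≤; punchOut-injective; toℕ-injective; toℕ<n;
  splitAt-↑ˡ; splitAt-↑ʳ; join-splitAt; remQuot-combine; combine-remQuot; toℕ-combine; combine-monoˡ-<;
  combine-injectiveˡ; combine-injectiveʳ; opposite-prop; opposite-involutive; ↑ʳ-injective)
import Data.Fin.Properties as Fin
open import Data.Fin.Permutation using (Permutation′; _⟨$⟩ʳ_; _⟨$⟩ˡ_; permutation; inverseˡ)
open import Data.List using (List; []; _∷_; _++_; map; concatMap; replicate; foldr; length; allFin; upTo)
open import Data.List.Properties using (length-tabulate; map-tabulate; tabulate-lookup)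
open import Data.List.Membership.Propositional using (_∈_)
open import Data.List.Membership.Propositional.Properties using (∈-upTo⁻; ∈-upTo⁺; ∈-allFin; ∈-lookup)
open import Data.List.Relation.Unary.Any using (here; there)
open import Data.List.Relation.Unary.All as All using (All; []; _∷_)
import Data.List.Relation.Unary.All.Properties as All
open import Data.List.Relation.Unary.AllPairs as AllPairs using (AllPairs; []; _∷_)
import Data.List.Relation.Unary.AllPairs.Properties as AllPairs
open import Data.Nat using (ℕ; zero; suc; _+_; _*_; _∸_; _⊔_; _≤_; _<_; _≤ᵇ_; _<ᵇ_; z≤n; s≤s; s≤s⁻¹; z<s; s<s)
open import Data.Nat.Properties
open import Algebra.Properties.CommutativeSemigroup +-commutativeSemigroup using (interchange)
open import Data.Nat.Solver using (module +-*-Solver)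
open import Data.Product using (_×_; _,_; proj₁; proj₂; ∃; uncurry)
open import Data.Sum using (_⊎_; inj₁; inj₂; [_,_])
open import Data.Unit using (tt)
open import Function using (_∘_; _⇔_; mk⇔; id; flip)
open import Function.Bundles using (module Equivalence)
open import Function.Definitions using (Injective)
open import Relation.Binary.Definitions using (tri<; tri≈; tri>)
open import Relation.Binary.PropositionalEquality hiding ([_])
open import Relation.Nullary using (¬_; yes; no; contradiction)
import Relation.Nullary.Reflects as Reflects

sumBy : ∀ {A : Set} → (A → ℕ) → List A → ℕ
sumBy f = foldr (λ x acc → f x + acc) 0

module _ {A : Set} where

  sumBy-cong : ∀ {f g : A → ℕ} (xs : List A) → (∀ x → f x ≡ g x) → sumBy f xs ≡ sumBy g xs
  sumBy-cong []       f≗g = refl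
  sumBy-cong (x ∷ xs) f≗g = cong₂ _+_ (f≗g x) (sumBy-cong xs f≗g)

  sumBy-mono-≤ : ∀ {f g : A → ℕ} (xs : List A) → (∀ x → f x ≤ g x) → sumBy f xs ≤ sumBy g xs
  sumBy-mono-≤ []       f≤g = z≤n
  sumBy-mono-≤ (x ∷ xs) f≤g = +-mono-≤ (f≤g x) (sumBy-mono-≤ xs f≤g)

  sumBy-mono-< : ∀ {f g : A → ℕ} {xs : List A} {y} → (∀ x → f x ≤ g x) → y ∈ xs → f y < g y →
                 sumBy f xs < sumBy g xs
  sumBy-mono-< {xs = x ∷ xs} f≤g (here refl) fy<gy = +-mono-<-≤ fy<gy (sumBy-mono-≤ xs f≤g)
  sumBy-mono-< {xs = x ∷ xs} f≤g (there y∈xs) fy<gy = +-mono-≤-< (f≤g x) (sumBy-mono-< f≤g y∈xs fy<gy)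

  sumBy-1≡length : (xs : List A) → sumBy (λ _ → 1) xs ≡ length xs
  sumBy-1≡length []       = refl
  sumBy-1≡length (x ∷ xs) = cong suc (sumBy-1≡length xs)

  sumBy-++ : (f : A → ℕ) (xs ys : List A) → sumBy f (xs ++ ys) ≡ sumBy f xs + sumBy f ys
  sumBy-++ f []       ys = refl
  sumBy-++ f (x ∷ xs) ys = trans (cong (f x +_) (sumBy-++ f xs ys)) (sym (+-assoc (f x) _ _))

  sumBy-replicate : (f : A → ℕ) (k : ℕ) (x : A) → sumBy f (replicate k x) ≡ k * f x
  sumBy-replicate f zero    x = refl
  sumBy-replicate f (suc k) x = cong (f x +_) (sumBy-replicate f k x)

  sumBy-+ : (f g : A → ℕ) (xs : List A) → sumBy (λ x → f x + g x) xs ≡ sumBy f xs + sumBy g xs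
  sumBy-+ f g []       = refl
  sumBy-+ f g (x ∷ xs) =
    trans (cong (f x + g x +_) (sumBy-+ f g xs)) (interchange (f x) (g x) (sumBy f xs) (sumBy g xs))

  sumBy-*ˡ : (k : ℕ) (f : A → ℕ) (xs : List A) → sumBy (λ x → k * f x) xs ≡ k * sumBy f xs
  sumBy-*ˡ k f []       = sym (*-zeroʳ k)
  sumBy-*ˡ k f (x ∷ xs) = trans (cong (k * f x +_) (sumBy-*ˡ k f xs)) (sym (*-distribˡ-+ k (f x) _))

  sumBy-zero : ∀ {f : A → ℕ} (xs : List A) → All (λ x → f x ≡ 0) xs → sumBy f xs ≡ 0
  sumBy-zero []       []           = refl
  sumBy-zero (x ∷ xs) (fx≡0 ∷ f≡0) = cong₂ _+_ fx≡0 (sumBy-zero xs f≡0)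

  sumBy-atMostOne : (f : A → ℕ) (xs : List A) → All (λ x → f x ≤ 1) xs →
                    AllPairs (λ x y → f x ≡ 0 ⊎ f y ≡ 0) xs → sumBy f xs ≤ 1
  sumBy-atMostOne f []       []           []                = z≤n
  sumBy-atMostOne f (x ∷ xs) (fx≤1 ∷ f≤1) (x-xs ∷ pairs) with f x ≟ 0
  ... | yes fx≡0 rewrite fx≡0 = sumBy-atMostOne f xs f≤1 pairs
  ... | no  fx≢0 rewrite sumBy-zero xs (All.map [ flip contradiction fx≢0 , id ] x-xs) =
    subst (_≤ 1) (sym (+-identityʳ (f x))) fx≤1

module _ {A B : Set} where

  sumBy-map : (f : B → ℕ) (g : A → B) (xs : List A) → sumBy f (map g xs) ≡ sumBy (f ∘ g) xs
  sumBy-map f g []       = refl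
  sumBy-map f g (x ∷ xs) = cong (f (g x) +_) (sumBy-map f g xs)

  sumBy-concatMap : (f : B → ℕ) (g : A → List B) (xs : List A) →
                    sumBy f (concatMap g xs) ≡ sumBy (sumBy f ∘ g) xs
  sumBy-concatMap f g []       = refl
  sumBy-concatMap f g (x ∷ xs) =
    trans (sumBy-++ f (g x) (concatMap g xs)) (cong (sumBy f (g x) +_) (sumBy-concatMap f g xs))

-- Crossings of a cut

indicator : Bool → ℕ
indicator b = if b then 1 else 0

crossing : ∀ {V : Set} → (V → Bool) → V × V → ℕ
crossing side (x , y) = indicator (side x xor side y)

crossings : ∀ {V : Set} → (V → Bool) → List (V × V) → ℕ
crossings side = sumBy (crossing side)

module _ {V : Set} (side : V → Bool) where

  crossing≤1 : ∀ e → crossing side e ≤ 1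
  crossing≤1 (x , y) with side x xor side y
  ... | true  = ≤-refl
  ... | false = z≤n

  crossing-sym : ∀ x y → crossing side (x , y) ≡ crossing side (y , x)
  crossing-sym x y = cong indicator (xor-comm (side x) (side y))

  crossing-not : ∀ e → crossing (not ∘ side) e ≡ crossing side e
  crossing-not (x , y) with side x | side y
  ... | true  | true  = refl
  ... | true  | false = refl
  ... | false | true  = refl
  ... | false | false = refl

  crossings-not : ∀ es → crossings (not ∘ side) es ≡ crossings side es
  crossings-not es = sumBy-cong es crossing-not

crossings-cong : ∀ {V : Set} {side side′ : V → Bool} (es : List (V × V)) →
                 (∀ z → side z ≡ side′ z) → crossings side es ≡ crossings side′ es
crossings-cong es side≗side′ =
  sumBy-cong es (λ (x , y) → cong₂ (λ a b → indicator (a xor b)) (side≗side′ x) (side≗side′ y))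

indicator-mono : ∀ {a b} → (T a → T b) → indicator a ≤ indicator b
indicator-mono {false}         _   = z≤n
indicator-mono {true}  {true}  _   = ≤-refl
indicator-mono {true}  {false} a⇒b = ⊥-elim (a⇒b tt)

indicator-< : ∀ {a b} → ¬ T a → T b → indicator a < indicator b
indicator-< {false} {true} _  _ = ≤-refl
indicator-< {true}         ¬a _ = ⊥-elim (¬a tt)

T⇒≤ : ∀ {a b} → (T a → T b) → a Bool.≤ b
T⇒≤ {false} {false} _   = Bool.b≤b
T⇒≤ {false} {true}  _   = Bool.f≤t
T⇒≤ {true}  {true}  _   = Bool.b≤b
T⇒≤ {true}  {false} a⇒b = ⊥-elim (a⇒b tt)

≤ᵇ-antitoneˡ : ∀ {m n} c → m ≤ n → (n ≤ᵇ c) Bool.≤ (m ≤ᵇ c)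
≤ᵇ-antitoneˡ c m≤n = T⇒≤ (λ n≤c → ≤⇒≤ᵇ (≤-trans m≤n (≤ᵇ⇒≤ _ c n≤c)))

not-antimono : ∀ {a b} → a Bool.≤ b → not b Bool.≤ not a
not-antimono Bool.b≤b = Bool.b≤b
not-antimono Bool.f≤t = Bool.f≤t

indicator-xor-transit : ∀ {p q r} → r Bool.≤ q → q Bool.≤ p →
                        indicator (p xor q) + indicator (q xor r) ≡ indicator (p xor r)
indicator-xor-transit {true}  Bool.b≤b Bool.b≤b = refl
indicator-xor-transit {false} Bool.b≤b Bool.b≤b = refl
indicator-xor-transit Bool.b≤b Bool.f≤t = refl
indicator-xor-transit Bool.f≤t Bool.b≤b = refl

<ᵇ-suc≡≤ᵇ : ∀ m n → (m <ᵇ suc n) ≡ (m ≤ᵇ n)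
<ᵇ-suc≡≤ᵇ zero    n       = refl
<ᵇ-suc≡≤ᵇ (suc m) zero    = refl
<ᵇ-suc≡≤ᵇ (suc m) (suc n) = refl

<ᵇ≡not-≤ᵇ : ∀ m n → (m <ᵇ n) ≡ not (n ≤ᵇ m)
<ᵇ≡not-≤ᵇ zero    zero    = refl
<ᵇ≡not-≤ᵇ zero    (suc n) = refl
<ᵇ≡not-≤ᵇ (suc m) zero    = refl
<ᵇ≡not-≤ᵇ (suc m) (suc n) = trans (<ᵇ≡not-≤ᵇ m n) (cong not (sym (<ᵇ-suc≡≤ᵇ n m)))

<ᵇ-irrefl : ∀ n → ¬ T (n <ᵇ n)
<ᵇ-irrefl n = <-irrefl refl ∘ <ᵇ⇒< n n

≤ᵇ-cong : ∀ {a b c d} → (a ≤ b ⇔ c ≤ d) → (a ≤ᵇ b) ≡ (c ≤ᵇ d)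
≤ᵇ-cong {a} {b} {c} {d} a≤b⇔c≤d =
  Reflects.det (≤ᵇ-reflects-≤ a b)
               (Reflects.fromEquivalence (from ∘ ≤ᵇ⇒≤ c d) (≤⇒≤ᵇ ∘ to))
  where open Equivalence a≤b⇔c≤d

module _ (H : Multigraph) (π : Ordering H) where
  open Multigraph H

  leftOfCut : ℕ → Fin n → Bool
  leftOfCut i z = pos H π z ≤ᵇ i

  crosses≡xor : ∀ i e → crosses H π i e ≡ (leftOfCut i (proj₁ e) xor leftOfCut i (proj₂ e))
  crosses≡xor i (u , v)
    rewrite <ᵇ≡not-≤ᵇ i (pos H π u) | <ᵇ≡not-≤ᵇ i (pos H π v) with leftOfCut i u | leftOfCut i v
  ... | true  | true  = refl
  ... | true  | false = refl
  ... | false | true  = refl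
  ... | false | false = refl

  cutSize≡crossings : ∀ i → cutSize H π i ≡ crossings (leftOfCut i) edges
  cutSize≡crossings i = sumBy-cong edges (cong indicator ∘ crosses≡xor i)

  width-≤ : ∀ {b} → (∀ i → i < n → cutSize H π i ≤ b) → width H π ≤ b
  width-≤ {b} cut≤b = foldr-⊔-≤ (upTo n) (λ i i∈ → cut≤b i (∈-upTo⁻ i∈))
    where
    foldr-⊔-≤ : ∀ is → (∀ i → i ∈ is → cutSize H π i ≤ b) → foldr _⊔_ 0 (map (cutSize H π) is) ≤ b
    foldr-⊔-≤ []       _     = z≤n
    foldr-⊔-≤ (i ∷ is) is≤b = ⊔-lub (is≤b i (here refl)) (foldr-⊔-≤ is (λ j j∈ → is≤b j (there j∈)))

  cutSize≤width : ∀ {i} → i < n → cutSize H π i ≤ width H π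
  cutSize≤width i<n = ≤-foldr-⊔ (upTo n) (∈-upTo⁺ i<n)
    where
    ≤-foldr-⊔ : ∀ {i} is → i ∈ is → cutSize H π i ≤ foldr _⊔_ 0 (map (cutSize H π) is)
    ≤-foldr-⊔ (j ∷ is) (here refl) = m≤m⊔n _ _
    ≤-foldr-⊔ (j ∷ is) (there i∈)  = ≤-trans (≤-foldr-⊔ is i∈) (m≤n⊔m _ _)

IsCutwidth-≤ : ∀ H {c b} → IsCutwidth H c → (π : Ordering H) →
               (∀ i → i < Multigraph.n H → cutSize H π i ≤ b) → c ≤ b
IsCutwidth-≤ H (_ , minimal) π cut≤b = ≤-trans (minimal π) (width-≤ H π cut≤b)

allPairs-path : ∀ {V : Set} {R : V → V → Set} {K} {a b : V} {h : Fin K → V} →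
  R a b → (∀ t → R a (h t)) → (∀ t → R (h t) b) → (∀ {t t′} → t Fin.< t′ → R (h t) (h t′)) →
  AllPairs R (a ∷ map h (allFin K) ++ b ∷ [])
allPairs-path Rab Rah Rhb Rhh =
  All.++⁺ (All.map⁺ (All.tabulate⁺ Rah)) (Rab ∷ [])
  ∷ AllPairs.++⁺ (AllPairs.map⁺ (AllPairs.tabulate⁺-< Rhh)) ([] ∷ [])
                 (All.map⁺ (All.tabulate⁺ (λ t → Rhb t ∷ [])))

module _ (G : SimpleGraph) {N : ℕ} where

  crossings-pathEdges-antitone : ∀ (side : Fin N → Bool) a xs b →
    AllPairs (λ x y → side y Bool.≤ side x) (a ∷ xs ++ b ∷ []) →
    crossings side (pathEdges G a xs b) ≡ crossing side (a , b)
  crossings-pathEdges-antitone side a []       b _ = +-identityʳ _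
  crossings-pathEdges-antitone side a (x ∷ xs) b ((x≤a ∷ _) ∷ x-rest@(x-tail ∷ _)) =
    trans (cong (crossing side (a , x) +_) (crossings-pathEdges-antitone side x xs b x-rest))
          (indicator-xor-transit b≤x x≤a)
    where
    b≤x : side b Bool.≤ side x
    b≤x with b≤x ∷ [] ← All.++⁻ʳ xs x-tail = b≤x

  crossings-pathEdges-monotone : ∀ (side : Fin N → Bool) a xs b →
    AllPairs (λ x y → side x Bool.≤ side y) (a ∷ xs ++ b ∷ []) →
    crossings side (pathEdges G a xs b) ≡ crossing side (a , b)
  crossings-pathEdges-monotone side a xs b monotone = begin
    crossings side (pathEdges G a xs b)          ≡⟨ crossings-not side (pathEdges G a xs b) ⟨
    crossings (not ∘ side) (pathEdges G a xs b)  ≡⟨ crossings-pathEdges-antitone (not ∘ side) a xs b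
                                                      (AllPairs.map not-antimono monotone) ⟩
    crossing (not ∘ side) (a , b)                ≡⟨ crossing-not side (a , b) ⟩
    crossing side (a , b)                        ∎
    where open ≡-Reasoning

-- Orderings sorted by an injective key

⟨$⟩ʳ-injective : ∀ {N} (π : Permutation′ N) → Injective _≡_ _≡_ (π ⟨$⟩ʳ_)
⟨$⟩ʳ-injective π {x} {y} eq = trans (sym (inverseˡ π)) (trans (cong (π ⟨$⟩ˡ_) eq) (inverseˡ π))

Fin-injective⇒surjective : ∀ {N} (f : Fin N → Fin N) → Injective _≡_ _≡_ f → ∀ y → ∃ λ x → f x ≡ y
Fin-injective⇒surjective {suc N} f f-injective y with any? (λ x → f x Fin.≟ y)
... | yes hit = hit
... | no  miss = contradiction (injective⇒≤ punchOut-injective′) (<-irrefl refl)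
  where
  f≢y : ∀ x → y ≢ f x
  f≢y x y≡fx = miss (x , sym y≡fx)
  punchOut-injective′ : Injective _≡_ _≡_ (λ x → punchOut (f≢y x))
  punchOut-injective′ {x} {x′} eq = f-injective (punchOut-injective (f≢y x) (f≢y x′) eq)

module SortBy {N : ℕ} (key : Fin N → ℕ) (key-injective : Injective _≡_ _≡_ key) where

  rank : Fin N → ℕ
  rank x = sumBy (λ y → indicator (key y <ᵇ key x)) (allFin N)

  rank-strictMono : ∀ {x y} → key x < key y → rank x < rank y
  rank-strictMono {x} {y} kx<ky = sumBy-mono-<
    (λ z → indicator-mono (λ kz<kx → <⇒<ᵇ (<-trans (<ᵇ⇒< _ _ kz<kx) kx<ky)))
    (∈-allFin x) (indicator-< (<ᵇ-irrefl (key x)) (<⇒<ᵇ kx<ky))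

  rank<N : ∀ x → rank x < N
  rank<N x = subst (rank x <_) (trans (sumBy-1≡length (allFin N)) (length-tabulate id))
    (sumBy-mono-< (λ _ → indicator-mono _) (∈-allFin x) (indicator-< (<ᵇ-irrefl (key x)) tt))

  key-≤⇒rank-≤ : ∀ {x y} → key x ≤ key y → rank x ≤ rank y
  key-≤⇒rank-≤ {x} {y} kx≤ky with m≤n⇒m<n∨m≡n kx≤ky
  ... | inj₁ kx<ky = <⇒≤ (rank-strictMono kx<ky)
  ... | inj₂ kx≡ky = ≤-reflexive (cong rank (key-injective kx≡ky))

  rank-≤⇒key-≤ : ∀ {x y} → rank x ≤ rank y → key x ≤ key y
  rank-≤⇒key-≤ rx≤ry = ≮⇒≥ (λ ky<kx → <⇒≱ (rank-strictMono ky<kx) rx≤ry)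

  rank-injective : Injective _≡_ _≡_ rank
  rank-injective rx≡ry =
    key-injective (≤-antisym (rank-≤⇒key-≤ (≤-reflexive rx≡ry))
                             (rank-≤⇒key-≤ (≤-reflexive (sym rx≡ry))))

  rankFin : Fin N → Fin N
  rankFin x = fromℕ< (rank<N x)

  rankFin-injective : Injective _≡_ _≡_ rankFin
  rankFin-injective {x} {y} eq = rank-injective (begin
    rank x            ≡⟨ toℕ-fromℕ< (rank<N x) ⟨
    toℕ (rankFin x)   ≡⟨ cong toℕ eq ⟩
    toℕ (rankFin y)   ≡⟨ toℕ-fromℕ< (rank<N y) ⟩
    rank y            ∎)
    where open ≡-Reasoning

  unrank : Fin N → Fin N
  unrank y = proj₁ (Fin-injective⇒surjective rankFin rankFin-injective y)

  rankFin-unrank : ∀ y → rankFin (unrank y) ≡ y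
  rankFin-unrank y = proj₂ (Fin-injective⇒surjective rankFin rankFin-injective y)

  sorted : Permutation′ N
  sorted = permutation rankFin unrank rankFin-unrank (λ x → rankFin-injective (rankFin-unrank (rankFin x)))

  sorted-pos : ∀ z → toℕ (sorted ⟨$⟩ʳ z) ≡ rank z
  sorted-pos z = toℕ-fromℕ< (rank<N z)

  sorted-cut : ∀ i → i < N → ∃ λ w → ∀ z → (toℕ (sorted ⟨$⟩ʳ z) ≤ᵇ i) ≡ (key z ≤ᵇ key w)
  sorted-cut i i<N = w , λ z → ≤ᵇ-cong (mk⇔
    (rank-≤⇒key-≤ ∘ subst₂ _≤_ (sorted-pos z) (sym rank-w))
    (subst₂ _≤_ (sym (sorted-pos z)) rank-w ∘ key-≤⇒rank-≤))
    where
    w : Fin N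
    w = unrank (fromℕ< i<N)
    rank-w : rank w ≡ i
    rank-w = begin
      rank w                ≡⟨ sorted-pos w ⟨
      toℕ (rankFin w)       ≡⟨ cong toℕ (rankFin-unrank (fromℕ< i<N)) ⟩
      toℕ (fromℕ< i<N)      ≡⟨ toℕ-fromℕ< i<N ⟩
      i                     ∎
      where open ≡-Reasoning

-- Subdividing the edges of a simple graph

combine-monoʳ-< : ∀ {m n} (i : Fin m) {j k : Fin n} → toℕ j < toℕ k → toℕ (combine i j) < toℕ (combine i k)
combine-monoʳ-< {n = n} i {j} {k} j<k =
  subst₂ _<_ (sym (toℕ-combine i j)) (sym (toℕ-combine i k)) (+-monoʳ-< (n * toℕ i) j<k)

opposite-strictAntitone : ∀ {n} {t t′ : Fin n} → toℕ t < toℕ t′ → toℕ (opposite t′) < toℕ (opposite t)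
opposite-strictAntitone {n} {t} {t′} t<t′ =
  subst₂ _<_ (sym (opposite-prop t′)) (sym (opposite-prop t)) (∸-monoʳ-< (s≤s t<t′) (toℕ<n t′))

orientFin : ∀ {K} → Bool → Fin K → Fin K
orientFin true  t = t
orientFin false t = opposite t

orientFin-injective : ∀ {K} b → Injective _≡_ _≡_ (orientFin {K} b)
orientFin-injective true  eq = eq
orientFin-injective false {t} {t′} eq =
  trans (sym (opposite-involutive t)) (trans (cong opposite eq) (opposite-involutive t′))

module Subdivision (G : SimpleGraph) (π₀ : Ordering (toMulti G)) (K : ℕ) where
  open SimpleGraph G using (n; edges; canon)

  M : ℕ
  M = m G

  V : Set
  V = Fin (n + M * K)

  original : Fin n → V
  original v = v ↑ˡ (M * K)

  inner : Fin M → Fin K → V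
  inner j t = n ↑ʳ combine j t

  start end : Fin M → Fin n
  start j = proj₁ (edge G j)
  end   j = proj₂ (edge G j)

  -- For K = k ∸ 1 these are, definitionally, the paths of stretch G k.
  edgePath : Fin M → List (V × V)
  edgePath j = pathEdges G (original (start j)) (map (inner j) (allFin K)) (original (end j))

  place : Fin n → ℕ
  place = pos (toMulti G) π₀

  ascending : Fin M → Bool
  ascending j = place (start j) <ᵇ place (end j)

  anchor : Fin M → Fin n
  anchor j = if ascending j then start j else end j

  Slot : Set
  Slot = Fin n × Fin (suc (M * K))

  -- Inner vertices of edge j sit right after its earlier endpoint, in the order met along the path.
  innerSlot : Fin M × Fin K → Slot
  innerSlot (j , t) = anchor j , Fin.suc (combine j (orientFin (ascending j) t))

  slotOf : Fin n ⊎ Fin (M * K) → Slot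
  slotOf (inj₁ v) = v , Fin.zero
  slotOf (inj₂ y) = innerSlot (remQuot K y)

  -- combine orders slots lexicographically: by the position of the anchor in π₀, then by offset.
  slotKey : Slot → ℕ
  slotKey (a , r) = toℕ (combine (π₀ ⟨$⟩ʳ a) r)

  key : V → ℕ
  key = slotKey ∘ slotOf ∘ splitAt n

  slotKey-injective : Injective _≡_ _≡_ slotKey
  slotKey-injective {a , r} {b , s} eq
    with combined ← toℕ-injective eq
    with refl ← ⟨$⟩ʳ-injective π₀ (combine-injectiveˡ (π₀ ⟨$⟩ʳ a) r (π₀ ⟨$⟩ʳ b) s combined)
    with refl ← combine-injectiveʳ (π₀ ⟨$⟩ʳ a) r (π₀ ⟨$⟩ʳ a) s combined = refl

  innerSlot-injective : Injective _≡_ _≡_ innerSlot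
  innerSlot-injective {j , t} {j′ , t′} eq
    with combined ← Fin.suc-injective (cong proj₂ eq)
    with refl ← combine-injectiveˡ j (orientFin (ascending j) t) j′ (orientFin (ascending j′) t′) combined =
    cong (j ,_) (orientFin-injective (ascending j) (combine-injectiveʳ j _ j _ combined))

  slotOf-injective : Injective _≡_ _≡_ slotOf
  slotOf-injective {inj₁ v} {inj₁ v′} refl = refl
  slotOf-injective {inj₂ y} {inj₂ y′} eq = cong inj₂ (begin
    y                                  ≡⟨ combine-remQuot {M} K y ⟨
    uncurry combine (remQuot {M} K y)  ≡⟨ cong (uncurry combine) (innerSlot-injective eq) ⟩
    uncurry combine (remQuot {M} K y′) ≡⟨ combine-remQuot {M} K y′ ⟩
    y′                                 ∎)
    where open ≡-Reasoning

  key-injective : Injective _≡_ _≡_ key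
  key-injective {x} {y} eq = begin
    x                            ≡⟨ join-splitAt n (M * K) x ⟨
    join n (M * K) (splitAt n x) ≡⟨ cong (join n (M * K)) (slotOf-injective slot≡) ⟩
    join n (M * K) (splitAt n y) ≡⟨ join-splitAt n (M * K) y ⟩
    y                            ∎
    where
    open ≡-Reasoning
    slot≡ : slotOf (splitAt n x) ≡ slotOf (splitAt n y)
    slot≡ = slotKey-injective {slotOf (splitAt n x)} {slotOf (splitAt n y)} eq

  key-original : ∀ v → key (original v) ≡ slotKey (v , Fin.zero)
  key-original v = cong (slotKey ∘ slotOf) (splitAt-↑ˡ n v (M * K))

  key-inner : ∀ j t → key (inner j t) ≡ slotKey (innerSlot (j , t))
  key-inner j t = trans (cong (slotKey ∘ slotOf) (splitAt-↑ʳ n (M * K) (combine j t)))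
                        (cong (slotKey ∘ innerSlot) (remQuot-combine j t))

  slotKey-monoˡ : ∀ {a b} r s → place a < place b → slotKey (a , r) < slotKey (b , s)
  slotKey-monoˡ r s = combine-monoˡ-< r s

  slotKey-monoʳ : ∀ a {r s} → toℕ r < toℕ s → slotKey (a , r) < slotKey (a , s)
  slotKey-monoʳ a = combine-monoʳ-< (π₀ ⟨$⟩ʳ a)

  slotKey-suc : ∀ a {r s} → toℕ s ≡ suc (toℕ r) → slotKey (a , s) ≡ suc (slotKey (a , r))
  slotKey-suc a {r} {s} s≡1+r = begin
    toℕ (combine (π₀ ⟨$⟩ʳ a) s)     ≡⟨ toℕ-combine (π₀ ⟨$⟩ʳ a) s ⟩
    B * place a + toℕ s             ≡⟨ cong (B * place a +_) s≡1+r ⟩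
    B * place a + suc (toℕ r)       ≡⟨ +-suc (B * place a) (toℕ r) ⟩
    suc (B * place a + toℕ r)       ≡⟨ cong suc (toℕ-combine (π₀ ⟨$⟩ʳ a) r) ⟨
    suc (toℕ (combine (π₀ ⟨$⟩ʳ a) r)) ∎
    where
    open ≡-Reasoning
    B = suc (M * K)

  slotKey-original-≤⇔ : ∀ v a r → slotKey (v , Fin.zero) ≤ slotKey (a , r) ⇔ place v ≤ place a
  slotKey-original-≤⇔ v a r = mk⇔
    (λ key≤ → ≮⇒≥ (λ pa<pv → <⇒≱ (slotKey-monoˡ r Fin.zero pa<pv) key≤))
    (λ pv≤pa → begin
      toℕ (combine (π₀ ⟨$⟩ʳ v) Fin.zero) ≡⟨ toℕ-combine (π₀ ⟨$⟩ʳ v) Fin.zero ⟩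
      B * place v + 0                    ≤⟨ +-mono-≤ (*-monoʳ-≤ B pv≤pa) z≤n ⟩
      B * place a + toℕ r                ≡⟨ toℕ-combine (π₀ ⟨$⟩ʳ a) r ⟨
      toℕ (combine (π₀ ⟨$⟩ʳ a) r)        ∎)
    where
    open ≤-Reasoning
    B = suc (M * K)

  place-start≢end : ∀ j → place (start j) ≢ place (end j)
  place-start≢end j eq =
    <-irrefl (cong toℕ (⟨$⟩ʳ-injective π₀ (toℕ-injective eq))) (All.lookup canon (∈-lookup j))

  ascending⇒< : ∀ {j} → ascending j ≡ true → place (start j) < place (end j)
  ascending⇒< asc = <ᵇ⇒< _ _ (subst T (sym asc) tt)

  descending⇒> : ∀ {j} → ascending j ≡ false → place (end j) < place (start j)
  descending⇒> {j} desc with <-cmp (place (start j)) (place (end j))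
  ... | tri< s<e _ _ = contradiction (subst T desc (<⇒<ᵇ s<e)) id
  ... | tri≈ _ s≡e _ = contradiction s≡e (place-start≢end j)
  ... | tri> _ _ e<s = e<s

  key-inner-ascending : ∀ {j} t → ascending j ≡ true →
                        key (inner j t) ≡ slotKey (start j , Fin.suc (combine j t))
  key-inner-ascending {j} t asc = trans (key-inner j t)
    (cong (λ b → slotKey ((if b then start j else end j) , Fin.suc (combine j (orientFin b t)))) asc)

  key-inner-descending : ∀ {j} t → ascending j ≡ false →
                         key (inner j t) ≡ slotKey (end j , Fin.suc (combine j (opposite t)))
  key-inner-descending {j} t desc = trans (key-inner j t)
    (cong (λ b → slotKey ((if b then start j else end j) , Fin.suc (combine j (orientFin b t)))) desc)

  pathVertices : Fin M → List V
  pathVertices j = original (start j) ∷ map (inner j) (allFin K) ++ original (end j) ∷ []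

  _<ₖ_ : V → V → Set
  x <ₖ y = key x < key y

  keys< : ∀ {x y p q} → key x ≡ slotKey p → key y ≡ slotKey q → slotKey p < slotKey q → x <ₖ y
  keys< kx ky = subst₂ _<_ (sym kx) (sym ky)

  pathVertices-ascending : ∀ {j} → ascending j ≡ true → AllPairs _<ₖ_ (pathVertices j)
  pathVertices-ascending {j} asc = allPairs-path
    (keys< (key-original _) (key-original _) (slotKey-monoˡ _ _ (ascending⇒< asc)))
    (λ t → keys< (key-original _) (key-inner-ascending t asc) (slotKey-monoʳ (start j) z<s))
    (λ t → keys< (key-inner-ascending t asc) (key-original _) (slotKey-monoˡ _ _ (ascending⇒< asc)))
    (λ {t} {t′} t<t′ → keys< (key-inner-ascending t asc) (key-inner-ascending t′ asc)
                             (slotKey-monoʳ (start j) (s<s (combine-monoʳ-< j t<t′))))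

  pathVertices-descending : ∀ {j} → ascending j ≡ false → AllPairs (flip _<ₖ_) (pathVertices j)
  pathVertices-descending {j} desc = allPairs-path
    (keys< (key-original _) (key-original _) (slotKey-monoˡ _ _ (descending⇒> desc)))
    (λ t → keys< (key-inner-descending t desc) (key-original _) (slotKey-monoˡ _ _ (descending⇒> desc)))
    (λ t → keys< (key-original _) (key-inner-descending t desc) (slotKey-monoʳ (end j) z<s))
    (λ {t} {t′} t<t′ → keys< (key-inner-descending t′ desc) (key-inner-descending t desc)
                             (slotKey-monoʳ (end j) (s<s (combine-monoʳ-< j (opposite-strictAntitone t<t′)))))

  below : V → V → Bool
  below w z = key z ≤ᵇ key w

  baseCut : V → ℕ
  baseCut w = place (proj₁ (slotOf (splitAt n w)))

  baseCut<n : ∀ w → baseCut w < n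
  baseCut<n w = toℕ<n (π₀ ⟨$⟩ʳ proj₁ (slotOf (splitAt n w)))

  baseSide : V → Fin n → Bool
  baseSide w = leftOfCut (toMulti G) π₀ (baseCut w)

  below-original : ∀ w v → below w (original v) ≡ baseSide w v
  below-original w v = trans (cong (_≤ᵇ key w) (key-original v)) (≤ᵇ-cong (slotKey-original-≤⇔ v _ _))

  crossings-edgePath : ∀ w j → crossings (below w) (edgePath j) ≡ crossing (baseSide w) (edge G j)
  crossings-edgePath w j = trans path≡endpoints endpoints
    where
    endpoints : crossing (below w) (original (start j) , original (end j)) ≡ crossing (baseSide w) (edge G j)
    endpoints = cong₂ (λ a b → indicator (a xor b)) (below-original w (start j)) (below-original w (end j))
    path≡endpoints : crossings (below w) (edgePath j) ≡ crossing (below w) (original (start j) , original (end j))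
    path≡endpoints with ascending j in asc
    ... | true  = crossings-pathEdges-antitone G (below w) _ _ _
                    (AllPairs.map (≤ᵇ-antitoneˡ (key w) ∘ <⇒≤) (pathVertices-ascending asc))
    ... | false = crossings-pathEdges-monotone G (below w) _ _ _
                    (AllPairs.map (≤ᵇ-antitoneˡ (key w) ∘ <⇒≤) (pathVertices-descending asc))

  open SortBy key key-injective public using (sorted)
  open SortBy key key-injective using (sorted-cut)

  -- Callers project out of this pair: matching on it with `with` would normalise `sorted`
  -- in the goal, which is very slow.
  cutSize-sorted : ∀ es i → i < n + M * K →
                   ∃ λ w → cutSize (mg (n + M * K) es) sorted i ≡ crossings (below w) es
  cutSize-sorted es i i<N = w , trans (cutSize≡crossings H sorted i) (crossings-cong es left≡below)
    where
    H = mg (n + M * K) es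
    w = proj₁ (sorted-cut i i<N)
    left≡below = proj₂ (sorted-cut i i<N)

  crossings-edgePaths : ∀ w → crossings (below w) (concatMap edgePath (allFin M)) ≡ crossings (baseSide w) edges
  crossings-edgePaths w = begin
    crossings (below w) (concatMap edgePath (allFin M)) ≡⟨ sumBy-concatMap _ edgePath (allFin M) ⟩
    sumBy (crossings (below w) ∘ edgePath) (allFin M)   ≡⟨ sumBy-cong (allFin M) (crossings-edgePath w) ⟩
    sumBy (crossing (baseSide w) ∘ edge G) (allFin M)   ≡⟨ sumBy-map (crossing (baseSide w)) (edge G) (allFin M) ⟨
    crossings (baseSide w) (map (edge G) (allFin M))    ≡⟨ cong (crossings (baseSide w)) edges≡ ⟩
    crossings (baseSide w) edges                        ∎
    where
    open ≡-Reasoning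
    edges≡ : map (edge G) (allFin M) ≡ edges
    edges≡ = trans (map-tabulate id (edge G)) (tabulate-lookup edges)

  inner-injectiveˡ : ∀ {j j′ t t′} → inner j t ≡ inner j′ t′ → j ≡ j′
  inner-injectiveˡ {j} {j′} {t} {t′} eq = combine-injectiveˡ j t j′ t′ (↑ʳ-injective n _ _ eq)

  crossing-consecutive : ∀ w {x y} → key y ≡ suc (key x) → crossing (below w) (x , y) ≢ 0 → w ≡ x
  crossing-consecutive w {x} {y} y≡1+x nz = go (below w x) (below w y) refl refl nz
    where
    go : ∀ bx by → below w x ≡ bx → below w y ≡ by → indicator (bx xor by) ≢ 0 → w ≡ x
    go true  true  _   _   nz = contradiction refl nz
    go false false _   _   nz = contradiction refl nz
    go true  false x≤w y≰w _  = key-injective (≤-antisym kw≤kx (≤ᵇ⇒≤ _ _ (subst T (sym x≤w) tt)))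
      where
      kw≤kx : key w ≤ key x
      kw≤kx = s≤s⁻¹ (subst (key w <_) y≡1+x (≰⇒> (subst T y≰w ∘ ≤⇒≤ᵇ)))
    go false true  x≰w y≤w _  = contradiction (≤⇒≤ᵇ kx≤kw) (subst T x≰w)
      where
      kx≤kw : key x ≤ key w
      kx≤kw = ≤-trans (subst (key x ≤_) (sym y≡1+x) (n≤1+n (key x))) (≤ᵇ⇒≤ _ _ (subst T (sym y≤w) tt))

cutSize-thicken : ∀ G k (π : Ordering (toMulti G)) i → cutSize (thicken G k) π i ≡ k * cutSize (toMulti G) π i
cutSize-thicken G k π i = begin
  sumBy crossesᵢ (concatMap (replicate k) edges) ≡⟨ sumBy-concatMap crossesᵢ (replicate k) edges ⟩
  sumBy (sumBy crossesᵢ ∘ replicate k) edges     ≡⟨ sumBy-cong edges (sumBy-replicate crossesᵢ k) ⟩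
  sumBy (λ e → k * crossesᵢ e) edges             ≡⟨ sumBy-*ˡ k crossesᵢ edges ⟩
  k * sumBy crossesᵢ edges                       ∎
  where
  open ≡-Reasoning
  open SimpleGraph G using (edges)
  crossesᵢ = λ e → indicator (crosses (toMulti G) π i e)

module _ (G : SimpleGraph) (π₀ : Ordering (toMulti G)) where
  open SimpleGraph G using (n; edges)

  crossings≤width : ∀ i → i < n → crossings (leftOfCut (toMulti G) π₀ i) edges ≤ width (toMulti G) π₀
  crossings≤width i i<n =
    subst (_≤ width (toMulti G) π₀) (cutSize≡crossings (toMulti G) π₀ i) (cutSize≤width (toMulti G) π₀ i<n)

  stretch-cutwidth≤width : ∀ k {c₁} → IsCutwidth (stretch G k) c₁ → c₁ ≤ width (toMulti G) π₀
  stretch-cutwidth≤width k ctw = IsCutwidth-≤ (stretch G k) ctw sorted cut≤width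
    where
    open Subdivision G π₀ (k ∸ 1)
    cut≤width : ∀ i → i < n + M * (k ∸ 1) → cutSize (stretch G k) sorted i ≤ width (toMulti G) π₀
    cut≤width i i<N = begin
      cutSize (stretch G k) sorted i                      ≡⟨ cut≡ ⟩
      crossings (below w) (concatMap edgePath (allFin M)) ≡⟨ crossings-edgePaths w ⟩
      crossings (baseSide w) edges                        ≤⟨ crossings≤width (baseCut w) (baseCut<n w) ⟩
      width (toMulti G) π₀                                ∎
      where
      open ≤-Reasoning
      w = proj₁ (cutSize-sorted (concatMap edgePath (allFin M)) i i<N)
      cut≡ = proj₂ (cutSize-sorted (concatMap edgePath (allFin M)) i i<N)

  thicken-cutwidth≤width : ∀ k {c₂} → IsCutwidth (thicken G k) c₂ → c₂ ≤ k * width (toMulti G) π₀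
  thicken-cutwidth≤width k ctw = IsCutwidth-≤ (thicken G k) ctw π₀ (λ i i<n →
    subst (_≤ _) (sym (cutSize-thicken G k π₀ i)) (*-monoʳ-≤ k (cutSize≤width (toMulti G) π₀ i<n)))

module InsulatedThickening (G : SimpleGraph) (π₀ : Ordering (toMulti G)) where
  open SimpleGraph G using (n; edges)
  open Subdivision G π₀ 2

  first second : Fin 2
  first  = Fin.zero
  second = Fin.suc Fin.zero

  middle : Fin M → V × V
  middle j = inner j first , inner j second

  -- Definitionally the edges that insulated G k puts in place of edge j.
  piece : ℕ → Fin M → List (V × V)
  piece k j = (original (start j) , proj₁ (middle j))
            ∷ (replicate k (middle j) ++ ((proj₂ (middle j) , original (end j)) ∷ []))

  crossings-piece : ∀ side k′ j →
    crossings side (piece (suc k′) j) ≡ crossings side (edgePath j) + k′ * crossing side (middle j)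
  crossings-piece side k′ j = begin
    a + (b + sumBy (crossing side) (replicate k′ (middle j) ++ _))  ≡⟨ cong (λ s → a + (b + s))
        (trans (sumBy-++ (crossing side) (replicate k′ (middle j)) _)
               (cong (_+ (c + 0)) (sumBy-replicate (crossing side) k′ (middle j)))) ⟩
    a + (b + (k′ * b + (c + 0)))                                     ≡⟨ rearrange a b c k′ ⟩
    a + (b + (c + 0)) + k′ * b                                       ∎
    where
    open ≡-Reasoning
    a = crossing side (original (start j) , proj₁ (middle j))
    b = crossing side (middle j)
    c = crossing side (proj₂ (middle j) , original (end j))
    rearrange : ∀ a b c k → a + (b + (k * b + (c + 0))) ≡ a + (b + (c + 0)) + k * b
    rearrange = +-*-Solver.solve 4
      (λ a b c k → a :+ (b :+ (k :* b :+ (c :+ con 0))) := a :+ (b :+ (c :+ con 0)) :+ k :* b) refl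
      where open +-*-Solver

  combine-second≡suc-first : ∀ (j : Fin M) → toℕ (combine j second) ≡ suc (toℕ (combine j first))
  combine-second≡suc-first j = trans (toℕ-combine j second)
    (trans (+-suc (2 * toℕ j) 0) (cong suc (sym (toℕ-combine j first))))

  middle-consecutive : ∀ j → key (proj₂ (middle j)) ≡ suc (key (proj₁ (middle j)))
                           ⊎ key (proj₁ (middle j)) ≡ suc (key (proj₂ (middle j)))
  middle-consecutive j with ascending j in orientation
  ... | true  = inj₁ (trans (key-inner-ascending {j} second orientation) (trans
                  (slotKey-suc (start j) {Fin.suc (combine j first)} {Fin.suc (combine j second)}
                    (cong suc (combine-second≡suc-first j)))
                  (cong suc (sym (key-inner-ascending {j} first orientation)))))
  ... | false = inj₂ (trans (key-inner-descending {j} first orientation) (trans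
                  (slotKey-suc (end j) {Fin.suc (combine j first)} {Fin.suc (combine j second)}
                    (cong suc (combine-second≡suc-first j)))
                  (cong suc (sym (key-inner-descending {j} second orientation)))))

  middle-crossing⇒inner : ∀ w j → crossing (below w) (middle j) ≢ 0 → ∃ λ s → w ≡ inner j s
  middle-crossing⇒inner w j nz with middle-consecutive j
  ... | inj₁ consecutive = first  , crossing-consecutive w consecutive nz
  ... | inj₂ consecutive = second , crossing-consecutive w consecutive (nz ∘ trans (crossing-sym (below w) _ _))

  middle-crossings≤1 : ∀ w → sumBy (crossing (below w) ∘ middle) (allFin M) ≤ 1
  middle-crossings≤1 w = sumBy-atMostOne δ (allFin M)
    (All.tabulate⁺ (crossing≤1 (below w) ∘ middle)) (AllPairs.tabulate⁺ atMostOne)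
    where
    δ = crossing (below w) ∘ middle
    atMostOne : ∀ {j j′} → j ≢ j′ → δ j ≡ 0 ⊎ δ j′ ≡ 0
    atMostOne {j} {j′} j≢j′ with δ j ≟ 0 | δ j′ ≟ 0
    ... | yes δj≡0 | _         = inj₁ δj≡0
    ... | no  _    | yes δj′≡0 = inj₂ δj′≡0
    ... | no  δj≢0 | no  δj′≢0 =
      let (_ , w≡j) = middle-crossing⇒inner w j δj≢0
          (_ , w≡j′) = middle-crossing⇒inner w j′ δj′≢0
      in contradiction (inner-injectiveˡ (trans (sym w≡j) w≡j′)) j≢j′

  crossings-pieces : ∀ k′ w → crossings (below w) (concatMap (piece (suc k′)) (allFin M))
                             ≡ crossings (baseSide w) edges + k′ * sumBy (crossing (below w) ∘ middle) (allFin M)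
  crossings-pieces k′ w = begin
    crossings (below w) (concatMap (piece (suc k′)) (allFin M))
      ≡⟨ sumBy-concatMap _ (piece (suc k′)) (allFin M) ⟩
    sumBy (crossings (below w) ∘ piece (suc k′)) (allFin M)
      ≡⟨ sumBy-cong (allFin M) (crossings-piece (below w) k′) ⟩
    sumBy (λ j → crossings (below w) (edgePath j) + k′ * δ j) (allFin M)
      ≡⟨ sumBy-+ _ _ (allFin M) ⟩
    sumBy (crossings (below w) ∘ edgePath) (allFin M) + sumBy (λ j → k′ * δ j) (allFin M)
      ≡⟨ cong₂ _+_ (sym (sumBy-concatMap _ edgePath (allFin M))) (sumBy-*ˡ k′ δ (allFin M)) ⟩
    crossings (below w) (concatMap edgePath (allFin M)) + k′ * sumBy δ (allFin M)
      ≡⟨ cong (_+ k′ * sumBy δ (allFin M)) (crossings-edgePaths w) ⟩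
    crossings (baseSide w) edges + k′ * sumBy δ (allFin M)
      ∎
    where
    open ≡-Reasoning
    δ = crossing (below w) ∘ middle

  insulated-cutwidth≤width : ∀ k′ {c₃} → IsCutwidth (insulated G (suc k′)) c₃ → c₃ ≤ width (toMulti G) π₀ + k′
  insulated-cutwidth≤width k′ ctw = IsCutwidth-≤ (insulated G (suc k′)) ctw sorted cut≤
    where
    cut≤ : ∀ i → i < n + M * 2 → cutSize (insulated G (suc k′)) sorted i ≤ width (toMulti G) π₀ + k′
    cut≤ i i<N = begin
      cutSize (insulated G (suc k′)) sorted i
        ≡⟨ trans cut≡ (crossings-pieces k′ w) ⟩
      crossings (baseSide w) edges + k′ * sumBy (crossing (below w) ∘ middle) (allFin M)
        ≤⟨ +-mono-≤ (crossings≤width G π₀ (baseCut w) (baseCut<n w)) (*-monoʳ-≤ k′ (middle-crossings≤1 w)) ⟩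
      width (toMulti G) π₀ + k′ * 1
        ≡⟨ cong (width (toMulti G) π₀ +_) (*-identityʳ k′) ⟩
      width (toMulti G) π₀ + k′ ∎
      where
      open ≤-Reasoning
      w = proj₁ (cutSize-sorted (concatMap (piece (suc k′)) (allFin M)) i i<N)
      cut≡ = proj₂ (cutSize-sorted (concatMap (piece (suc k′)) (allFin M)) i i<N)


lemma8 : (G : SimpleGraph) (k : ℕ) → 1 ≤ k → (c : ℕ) → IsCutwidth (toMulti G) c →
    ((c₁ : ℕ) → IsCutwidth (stretch G k) c₁ → c₁ ≤ c)
    × ((c₂ : ℕ) → IsCutwidth (thicken G k) c₂ → c₂ ≤ k * c)
    × ((c₃ : ℕ) → IsCutwidth (insulated G k) c₃ → c₃ ≤ c + k ∸ 1)
lemma8 G (suc k′) _ c ((π₀ , width≡c) , _) =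
  (λ c₁ ctw → subst (c₁ ≤_) width≡c (stretch-cutwidth≤width G π₀ (suc k′) ctw)) ,
  (λ c₂ ctw → subst (λ w → c₂ ≤ suc k′ * w) width≡c (thicken-cutwidth≤width G π₀ (suc k′) ctw)) ,
  (λ c₃ ctw → subst (c₃ ≤_) (trans (cong (_+ k′) width≡c) (cong (_∸ 1) (sym (+-suc c k′))))
                     (InsulatedThickening.insulated-cutwidth≤width G π₀ k′ ctw))
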